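{- Let $\mathcal{J}$ be a symmetric matrix of nonnegative integers with finitely many nonzero entries such that $\mathcal{D}_k=\frac1k(\mathcal{J}_{k,k}+\sum_l\mathcal{J}_{k,l})$ is an integer for every $k$, $\mathcal{J}_{k,l}\le\mathcal{D}_k\mathcal{D}_l$ for all $k\neq l$, and $\mathcal{J}_{k,k}\le\binom{\mathcal{D}_k}{2}$ for all $k$. Let $d_1\ge d_2\ge\dots\ge d_n$ be the degree sequence containing exactly $\mathcal{D}_k$ entries equal to $k$ for each $k$. Then for every $k\le n$, $$\sum_{i=1}^k d_i\le k(k-1)+\sum_{i=k+1}^n\min(d_i,k).$$
   Context: $\mathcal{J}$ plays the role of a joint degree matrix: $\mathcal{J}_{k,l}$ is the intended number of edges between vertices of degree $k$ and vertices of degree $l$, and $\mathcal{D}_k$ the corresponding number of vertices of degree $k$. -}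

module Defs where

open import Data.Nat using (ℕ; zero; suc; _+_; _*_; _∸_; _≤_; _/_; _⊓_)
open import Data.Nat.Combinatorics using (_C_)
open import Data.List using (List; []; _++_; replicate; applyUpTo; map; take; drop)
open import Data.Nat.ListAction using (sum)

-- A "matrix" indexed by positive integers, represented as J : ℕ → ℕ → ℕ
-- whose nonzero entries all lie in {1..K} × {1..K}.

rowSum : (ℕ → ℕ → ℕ) → ℕ → ℕ → ℕ
rowSum J K k = sum (applyUpTo (λ i → J k (suc i)) K)

-- D_k = (J_{k,k} + Σ_l J_{k,l}) / k   (k ≥ 1; D_0 := 0 is never used)
Dk : (ℕ → ℕ → ℕ) → ℕ → ℕ → ℕ
Dk J K zero = 0
Dk J K (suc m) = (J (suc m) (suc m) + rowSum J K (suc m)) / suc m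

degSeqFrom : (ℕ → ℕ) → ℕ → List ℕ
degSeqFrom D zero = []
degSeqFrom D (suc m) = replicate (D (suc m)) (suc m) ++ degSeqFrom D m

degSeq : (ℕ → ℕ → ℕ) → ℕ → List ℕ
degSeq J K = degSeqFrom (Dk J K) K

module Submission where

-- Fix k and write the k largest degrees as all N vertices of the classes
-- a > t together with r vertices (1 ≤ r ≤ D_t) of a class t, so k = N + r.
-- No graph is available, so the r chosen vertices of class t are treated
-- "fractionally": multiplying the degree sum by the weight D_t and expanding
-- every a · D_a = J_aa + Σ_l J_al (the divisibility hypothesis) splits the
-- weighted degree sum into edges inside the high classes, between the high
-- classes and t, inside t, and towards the low classes l < t.  Each part is
-- bounded by the hypotheses J_kl ≤ D_k D_l and 2 J_kk + D_k ≤ D_k², and the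
-- bounds add up to D_t times the right-hand side k(k-1) + Σ_{i>k} min(d_i,k).

open import Defs
open import Data.Nat using (ℕ; zero; suc; _+_; _*_; _∸_; _≤_; _<_; _⊓_; z≤n; s≤s; NonZero; >-nonZero)
open import Data.Nat.Properties
open import Data.Nat.Divisibility using (_∣_)
open import Data.Nat.DivMod using (m*[n/m]≡n)
open import Data.Nat.Combinatorics using (_C_; nC1≡n; nCk+nC[k+1]≡[n+1]C[k+1]; k>n⇒nCk≡0)
open import Data.Nat.Tactic.RingSolver using (solve-∀)
open import Data.List using (List; _∷_; _++_; replicate; applyUpTo; length; map; take; drop)
open import Data.List.Properties using (length-++; length-replicate; map-++; map-replicate)
open import Data.Nat.ListAction using (sum)
open import Data.Nat.ListAction.Properties using (sum-++)
open import Data.Product using (_×_; _,_)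
open import Data.Sum using (inj₁; inj₂)
open import Relation.Nullary using (yes; no)
open import Relation.Binary.PropositionalEquality

∑ : ℕ → (ℕ → ℕ) → ℕ
∑ zero    f = 0
∑ (suc n) f = f n + ∑ n f

infix 5 ∑
syntax ∑ n (λ i → e) = ∑[ i < n ] e

∑-applyUpTo : ∀ n f → sum (applyUpTo f n) ≡ ∑ n f
∑-applyUpTo zero    f = refl
∑-applyUpTo (suc n) f = trans (cong (f 0 +_) (∑-applyUpTo n (λ i → f (suc i)))) (peel n)
  where
  peel : ∀ n → f 0 + (∑[ i < n ] f (suc i)) ≡ ∑ (suc n) f
  peel zero    = refl
  peel (suc n) = trans (x+[y+z]≡y+[x+z] (f 0) (f (suc n)) _) (cong (f (suc n) +_) (peel n))
    where
    x+[y+z]≡y+[x+z] : ∀ x y z → x + (y + z) ≡ y + (x + z)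
    x+[y+z]≡y+[x+z] = solve-∀

∑-split : ∀ m n f → ∑ (m + n) f ≡ (∑[ j < n ] f (m + j)) + ∑ m f
∑-split m zero    f = cong (λ x → ∑ x f) (+-identityʳ m)
∑-split m (suc n) f rewrite +-suc m n | ∑-split m n f = sym (+-assoc (f (m + n)) _ _)

∑-+ : ∀ n f g → ∑[ i < n ] (f i + g i) ≡ ∑ n f + ∑ n g
∑-+ zero    f g = refl
∑-+ (suc n) f g rewrite ∑-+ n f g = interchange (f n) (g n) (∑ n f) (∑ n g)
  where
  interchange : ∀ a b c d → (a + b) + (c + d) ≡ (a + c) + (b + d)
  interchange = solve-∀

∑-*ˡ : ∀ n c f → c * ∑ n f ≡ ∑[ i < n ] (c * f i)
∑-*ˡ zero    c f = *-zeroʳ c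
∑-*ˡ (suc n) c f rewrite *-distribˡ-+ c (f n) (∑ n f) | ∑-*ˡ n c f = refl

∑-cong : ∀ n {f g} → (∀ i → i < n → f i ≡ g i) → ∑ n f ≡ ∑ n g
∑-cong zero    eq = refl
∑-cong (suc n) eq = cong₂ _+_ (eq n ≤-refl) (∑-cong n (λ i i<n → eq i (m<n⇒m<1+n i<n)))

∑-mono : ∀ n {f g} → (∀ i → i < n → f i ≤ g i) → ∑ n f ≤ ∑ n g
∑-mono zero    le = z≤n
∑-mono (suc n) le = +-mono-≤ (le n ≤-refl) (∑-mono n (λ i i<n → le i (m<n⇒m<1+n i<n)))

∑-swap : ∀ m n (f : ℕ → ℕ → ℕ) → ∑[ i < m ] ∑[ j < n ] f i j ≡ ∑[ j < n ] ∑[ i < m ] f i j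
∑-swap zero    n f = sym (∑-zero n)
  where
  ∑-zero : ∀ n → ∑[ _ < n ] 0 ≡ 0
  ∑-zero zero    = refl
  ∑-zero (suc n) = ∑-zero n
∑-swap (suc m) n f rewrite ∑-swap m n f = sym (∑-+ n (f m) (λ j → ∑[ i < m ] f i j))

∑-mono-surplus : ∀ n {f g} j₀ E → j₀ < n → (∀ j → j < n → j ≢ j₀ → f j ≤ g j) →
  f j₀ + E ≤ g j₀ → ∑ n f + E ≤ ∑ n g
∑-mono-surplus (suc n) {f} {g} j₀ E j₀<1+n le le₀ with j₀ ≟ n
... | yes refl = begin
  f n + ∑ n f + E   ≡⟨ +-assoc (f n) _ E ⟩
  f n + (∑ n f + E) ≡⟨ cong (f n +_) (+-comm (∑ n f) E) ⟩
  f n + (E + ∑ n f) ≡⟨ sym (+-assoc (f n) E _) ⟩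
  f n + E + ∑ n f   ≤⟨ +-mono-≤ le₀ (∑-mono n (λ j j<n → le j (m<n⇒m<1+n j<n) (<⇒≢ j<n))) ⟩
  g n + ∑ n g       ∎
  where open ≤-Reasoning
... | no j₀≢n = begin
  f n + ∑ n f + E   ≡⟨ +-assoc (f n) _ E ⟩
  f n + (∑ n f + E) ≤⟨ +-mono-≤ (le n ≤-refl (λ eq → j₀≢n (sym eq)))
                                (∑-mono-surplus n j₀ E j₀<n (λ j j<n → le j (m<n⇒m<1+n j<n)) le₀) ⟩
  g n + ∑ n g       ∎
  where
  open ≤-Reasoning
  j₀<n : j₀ < n
  j₀<n = ≤∧≢⇒< (≤-pred j₀<1+n) j₀≢n

-- The diagonal hypothesis J_kk ≤ (D_k choose 2) is used in the form 2 J_kk + D_k ≤ D_k².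
double-choose-2 : ∀ n → 2 * (n C 2) + n ≡ n * n
double-choose-2 zero    = cong (λ c → 2 * c + 0) (k>n⇒nCk≡0 {0} {2} (s≤s z≤n))
double-choose-2 (suc n) = begin
  2 * (suc n C 2) + suc n          ≡⟨ cong (λ c → 2 * c + suc n) (sym (nCk+nC[k+1]≡[n+1]C[k+1] n 1)) ⟩
  2 * (n C 1 + n C 2) + suc n      ≡⟨ cong (λ c → 2 * (c + n C 2) + suc n) (nC1≡n n) ⟩
  2 * (n + n C 2) + suc n          ≡⟨ regroup n (n C 2) ⟩
  suc (2 * n + (2 * (n C 2) + n))  ≡⟨ cong (λ c → suc (2 * n + c)) (double-choose-2 n) ⟩
  suc (2 * n + n * n)              ≡⟨ square-suc n ⟩
  suc n * suc n                    ∎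
  where
  open ≡-Reasoning
  regroup : ∀ n c → 2 * (n + c) + suc n ≡ suc (2 * n + (2 * c + n))
  regroup = solve-∀
  square-suc : ∀ n → suc (2 * n + n * n) ≡ suc n * suc n
  square-suc = solve-∀

square-split : ∀ k → k * (k ∸ 1) + k ≡ k * k
square-split zero    = refl
square-split (suc k) = trans (+-comm (suc k * k) (suc k)) (sym (*-suc (suc k) k))

-- Class t has r + e vertices, r of them chosen, and 2J + (r+e) ≤ (r+e)² for
-- J = J_tt.  Counting all internal edges with weight r gives the bound
-- r(r+e)² = r·r(r+e) + e·r(r+e): the chosen share plus the full capacity of
-- the e unchosen vertices.
weighted-diagonal : ∀ r e J → 2 * J + (r + e) ≤ (r + e) * (r + e) →
  2 * r * J + r * (r + e) ≤ r * r * (r + e) + e * (r * (r + e))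
weighted-diagonal r e J h = begin
  2 * r * J + r * (r + e)               ≡⟨ factor r e J ⟩
  r * (2 * J + (r + e))                 ≤⟨ *-monoʳ-≤ r h ⟩
  r * ((r + e) * (r + e))               ≡⟨ expand r e ⟩
  r * r * (r + e) + e * (r * (r + e))   ∎
  where
  open ≤-Reasoning
  factor : ∀ r e J → 2 * r * J + r * (r + e) ≡ r * (2 * J + (r + e))
  factor = solve-∀
  expand : ∀ r e → r * ((r + e) * (r + e)) ≡ r * r * (r + e) + e * (r * (r + e))
  expand = solve-∀

-- Bound (C) on the internal edges of class t: the spill-over to the e unchosen
-- vertices needs only min(r(r+e), 2J).  When 2J is the minimum and e ≥ 1 the
-- weight difference between chosen and unchosen vertices pays for it.
class-t-internal : ∀ {w} r e J → w ≡ r + e → 1 ≤ r → 2 * J + w ≤ w * w →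
  2 * r * J + r * w ≤ r * r * w + e * ((r * w) ⊓ (2 * J))
class-t-internal r zero J refl _ h = weighted-diagonal r 0 J h
class-t-internal r e@(suc e′) J refl 1≤r h with ≤-total (r * (r + e)) (2 * J)
... | inj₁ full rewrite m≤n⇒m⊓n≡m full = weighted-diagonal r e J h
... | inj₂ partial rewrite m≥n⇒m⊓n≡n partial with ≤-total r e
...   | inj₁ r≤e = begin
  2 * r * J + r * (r + e)         ≡⟨ cong (_+ r * (r + e)) (reassoc r J) ⟩
  r * (2 * J) + r * (r + e)       ≤⟨ +-mono-≤ (*-monoˡ-≤ (2 * J) r≤e) (*-monoˡ-≤ (r + e) (m≤m*n r r {{>-nonZero 1≤r}})) ⟩
  e * (2 * J) + r * r * (r + e)   ≡⟨ +-comm (e * (2 * J)) _ ⟩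
  r * r * (r + e) + e * (2 * J)   ∎
  where
  open ≤-Reasoning
  reassoc : ∀ r J → 2 * r * J ≡ r * (2 * J)
  reassoc = solve-∀
...   | inj₂ e≤r with m≤n⇒∃[o]m+o≡n e≤r
...     | d , refl = begin
  2 * (e + d) * J + R                   ≡⟨ split-chosen e d J ⟩
  e * (2 * J) + d * (2 * J) + R         ≤⟨ +-monoˡ-≤ R (+-monoʳ-≤ (e * (2 * J)) (*-monoʳ-≤ d partial)) ⟩
  e * (2 * J) + d * R + R               ≤⟨ m≤m+n _ (e′ * R) ⟩
  e * (2 * J) + d * R + R + e′ * R      ≡⟨ collect e′ d J ⟩
  (e + d) * (e + d) * ((e + d) + e) + e * (2 * J) ∎
  where
  open ≤-Reasoning
  R : ℕ
  R = (e + d) * ((e + d) + e)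
  split-chosen : ∀ e d J → 2 * (e + d) * J + (e + d) * ((e + d) + e)
    ≡ e * (2 * J) + d * (2 * J) + (e + d) * ((e + d) + e)
  split-chosen = solve-∀
  collect : ∀ e′ d J → suc e′ * (2 * J) + d * ((suc e′ + d) * ((suc e′ + d) + suc e′))
      + (suc e′ + d) * ((suc e′ + d) + suc e′) + e′ * ((suc e′ + d) * ((suc e′ + d) + suc e′))
    ≡ (suc e′ + d) * (suc e′ + d) * ((suc e′ + d) + suc e′) + suc e′ * (2 * J)
  collect = solve-∀

-- Bound (B), for one high class a of size Da: the x = J_at edges to class t are
-- counted with weight r + e from a and weight r from t.
high-to-t : ∀ {w} r e x Da → w ≡ r + e → x ≤ Da * w → w * x + r * x ≤ e * x + 2 * r * (w * Da)
high-to-t r e x Da refl x≤ = begin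
  (r + e) * x + r * x          ≡⟨ regroup r e x ⟩
  e * x + 2 * r * x            ≤⟨ +-monoʳ-≤ (e * x) (*-monoʳ-≤ (2 * r) (subst (x ≤_) (*-comm Da (r + e)) x≤)) ⟩
  e * x + 2 * r * ((r + e) * Da) ∎
  where
  open ≤-Reasoning
  regroup : ∀ r e x → (r + e) * x + r * x ≡ e * x + 2 * r * x
  regroup = solve-∀

-- Bound (D), for one low class b of size Db: the S edges from the high classes
-- (weight w) and the x edges from class t (weight r ≤ w) are at most
-- w · Db · min(b, N + r), by the degree of b and by the sizes of the other side.
low-class : ∀ w r S x b Db N → r ≤ w → S + x ≤ b * Db → S ≤ Db * N → x ≤ w * Db →
  w * S + r * x ≤ w * (Db * (b ⊓ (N + r)))
low-class w r S x b Db N r≤w byDegree byHigh byT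
  rewrite *-distribˡ-⊓ Db b (N + r) | *-distribˡ-⊓ w (Db * b) (Db * (N + r)) =
    ⊓-glb viaDegree viaSize
  where
  open ≤-Reasoning
  viaDegree : w * S + r * x ≤ w * (Db * b)
  viaDegree = begin
    w * S + r * x  ≤⟨ +-monoʳ-≤ (w * S) (*-monoˡ-≤ x r≤w) ⟩
    w * S + w * x  ≡⟨ sym (*-distribˡ-+ w S x) ⟩
    w * (S + x)    ≤⟨ *-monoʳ-≤ w byDegree ⟩
    w * (b * Db)   ≡⟨ cong (w *_) (*-comm b Db) ⟩
    w * (Db * b)   ∎
  viaSize : w * S + r * x ≤ w * (Db * (N + r))
  viaSize = begin
    w * S + r * x              ≤⟨ +-mono-≤ (*-monoʳ-≤ w byHigh) (*-monoʳ-≤ r byT) ⟩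
    w * (Db * N) + r * (w * Db) ≡⟨ regroup w r Db N ⟩
    w * (Db * (N + r))         ∎
    where
    regroup : ∀ w r Db N → w * (Db * N) + r * (w * Db) ≡ w * (Db * (N + r))
    regroup = solve-∀

-- Bound (E), the spill-over terms at class t: S = Σ_a J_at edges to the high
-- classes and at most min(r·w, 2 J_tt) internal ones fit into w · min(t, N + r).
class-t-total : ∀ w r JJ S t N → S + 2 * JJ ≤ t * w → S ≤ w * N →
  S + ((r * w) ⊓ (2 * JJ)) ≤ w * (t ⊓ (N + r))
class-t-total w r JJ S t N byDegree byHigh rewrite *-distribˡ-⊓ w t (N + r) =
  ⊓-glb viaDegree viaSize
  where
  viaDegree : S + ((r * w) ⊓ (2 * JJ)) ≤ w * t
  viaDegree = ≤-trans (+-monoʳ-≤ S (m⊓n≤n (r * w) (2 * JJ))) (subst (S + 2 * JJ ≤_) (*-comm t w) byDegree)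
  viaSize : S + ((r * w) ⊓ (2 * JJ)) ≤ w * (N + r)
  viaSize = subst (S + ((r * w) ⊓ (2 * JJ)) ≤_) (regroup w N r) (+-mono-≤ byHigh (m⊓n≤m (r * w) (2 * JJ)))
    where
    regroup : ∀ w N r → w * N + r * w ≡ w * (N + r)
    regroup = solve-∀

-- Adding up the bounds (A)–(E) against the weighted degree sum w · LHS.
assemble : ∀ {LHS SA SB SD JJ SJt X N r e m Ls} w →
  w * LHS ≡ w * SA + SB + 2 * r * JJ + SD →
  SA + N ≤ N * N →
  SB ≤ e * SJt + 2 * r * (w * N) →
  2 * r * JJ + r * w ≤ r * r * w + e * X →
  SD ≤ w * Ls →
  SJt + X ≤ w * m →
  w * (LHS + (N + r)) ≤ w * ((N + r) * (N + r) + (e * m + Ls))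
assemble {LHS} {SA} {SB} {SD} {JJ} {SJt} {X} {N} {r} {e} {m} {Ls} w eq hA hB hC hD hE = begin
  w * (LHS + (N + r))
    ≡⟨ *-distribˡ-+ w LHS (N + r) ⟩
  w * LHS + w * (N + r)
    ≡⟨ cong (_+ w * (N + r)) eq ⟩
  w * SA + SB + 2 * r * JJ + SD + w * (N + r)
    ≡⟨ regroup w SA SB JJ SD N r ⟩
  w * (SA + N) + SB + (2 * r * JJ + r * w) + SD
    ≤⟨ +-mono-≤ (+-mono-≤ (+-mono-≤ (*-monoʳ-≤ w hA) hB) hC) hD ⟩
  w * (N * N) + (e * SJt + 2 * r * (w * N)) + (r * r * w + e * X) + w * Ls
    ≡⟨ isolate w SJt X N r e Ls ⟩
  w * (N * N) + 2 * r * (w * N) + r * r * w + w * Ls + e * (SJt + X)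
    ≤⟨ +-monoʳ-≤ (w * (N * N) + 2 * r * (w * N) + r * r * w + w * Ls) (*-monoʳ-≤ e hE) ⟩
  w * (N * N) + 2 * r * (w * N) + r * r * w + w * Ls + e * (w * m)
    ≡⟨ complete w N r e m Ls ⟩
  w * ((N + r) * (N + r) + (e * m + Ls)) ∎
  where
  open ≤-Reasoning
  regroup : ∀ w SA SB JJ SD N r → w * SA + SB + 2 * r * JJ + SD + w * (N + r)
    ≡ w * (SA + N) + SB + (2 * r * JJ + r * w) + SD
  regroup = solve-∀
  isolate : ∀ w SJt X N r e Ls → w * (N * N) + (e * SJt + 2 * r * (w * N)) + (r * r * w + e * X) + w * Ls
    ≡ w * (N * N) + 2 * r * (w * N) + r * r * w + w * Ls + e * (SJt + X)
  isolate = solve-∀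
  complete : ∀ w N r e m Ls → w * (N * N) + 2 * r * (w * N) + r * r * w + w * Ls + e * (w * m)
    ≡ w * ((N + r) * (N + r) + (e * m + Ls))
  complete = solve-∀

cancel-weight : ∀ w k {a R} .{{_ : NonZero w}} → w * (a + k) ≤ w * (k * k + R) → a ≤ k * (k ∸ 1) + R
cancel-weight w k {a} {R} le = +-cancelʳ-≤ k a (k * (k ∸ 1) + R) (begin
  a + k                 ≤⟨ *-cancelˡ-≤ w le ⟩
  k * k + R             ≡⟨ cong (_+ R) (sym (square-split k)) ⟩
  k * (k ∸ 1) + k + R   ≡⟨ +-assoc (k * (k ∸ 1)) k R ⟩
  k * (k ∸ 1) + (k + R) ≡⟨ cong (k * (k ∸ 1) +_) (+-comm k R) ⟩
  k * (k ∸ 1) + (R + k) ≡⟨ sym (+-assoc (k * (k ∸ 1)) R k) ⟩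
  k * (k ∸ 1) + R + k   ∎)
  where open ≤-Reasoning

above : ℕ → ℕ → ℕ
above t j = suc t + j

sum-replicate : ∀ c x → sum (replicate c x) ≡ c * x
sum-replicate zero    x = refl
sum-replicate (suc c) x = cong (x +_) (sum-replicate c x)

sum-map-replicate-++ : ∀ (f : ℕ → ℕ) c x ys → sum (map f (replicate c x ++ ys)) ≡ c * f x + sum (map f ys)
sum-map-replicate-++ f c x ys = begin
  sum (map f (replicate c x ++ ys))                 ≡⟨ cong sum (map-++ f (replicate c x) ys) ⟩
  sum (map f (replicate c x) ++ map f ys)           ≡⟨ sum-++ (map f (replicate c x)) (map f ys) ⟩
  sum (map f (replicate c x)) + sum (map f ys)      ≡⟨ cong (λ l → sum l + sum (map f ys)) (map-replicate f c x) ⟩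
  sum (replicate c (f x)) + sum (map f ys)          ≡⟨ cong (_+ sum (map f ys)) (sum-replicate c (f x)) ⟩
  c * f x + sum (map f ys)                          ∎
  where open ≡-Reasoning

take-replicate-++ : ∀ {r c} x (ys : List ℕ) → r ≤ c → take r (replicate c x ++ ys) ≡ replicate r x
take-replicate-++ {zero}          x ys _         = refl
take-replicate-++ {suc r} {suc c} x ys (s≤s r≤c) = cong (x ∷_) (take-replicate-++ x ys r≤c)

drop-replicate-++ : ∀ {r c} x (ys : List ℕ) → r ≤ c → drop r (replicate c x ++ ys) ≡ replicate (c ∸ r) x ++ ys
drop-replicate-++ {zero}          x ys _         = refl
drop-replicate-++ {suc r} {suc c} x ys (s≤s r≤c) = drop-replicate-++ x ys r≤c

take-past-replicate : ∀ c k x (ys : List ℕ) → take (c + k) (replicate c x ++ ys) ≡ replicate c x ++ take k ys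
take-past-replicate zero    k x ys = refl
take-past-replicate (suc c) k x ys = cong (x ∷_) (take-past-replicate c k x ys)

drop-past-replicate : ∀ c k x (ys : List ℕ) → drop (c + k) (replicate c x ++ ys) ≡ drop k ys
drop-past-replicate zero    k x ys = refl
drop-past-replicate (suc c) k x ys = drop-past-replicate c k x ys

length-degSeqFrom-suc : ∀ D m → length (degSeqFrom D (suc m)) ≡ D (suc m) + length (degSeqFrom D m)
length-degSeqFrom-suc D m =
  trans (length-++ (replicate (D (suc m)) (suc m))) (cong (_+ length (degSeqFrom D m)) (length-replicate (D (suc m))))

sum-map-degSeqFrom : ∀ D (f : ℕ → ℕ) u → sum (map f (degSeqFrom D u)) ≡ ∑[ i < u ] D (suc i) * f (suc i)
sum-map-degSeqFrom D f zero    = refl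
sum-map-degSeqFrom D f (suc u) =
  trans (sum-map-replicate-++ f (D (suc u)) (suc u) (degSeqFrom D u)) (cong (D (suc u) * f (suc u) +_) (sum-map-degSeqFrom D f u))

-- A prefix of length k ≥ 1 of the degree sequence consists of all vertices of
-- the classes above t = u + 1 (the classes t+1 … K, with K = t + n) and of
-- 1 ≤ r ≤ D_t vertices of class t; the suffix holds the rest of class t and
-- the classes 1 … u.
record PrefixSplit (D : ℕ → ℕ) (K k : ℕ) : Set where
  constructor prefix-split
  field
    u n r  : ℕ
    K≡     : K ≡ suc u + n
    1≤r    : 1 ≤ r
    r≤D    : r ≤ D (suc u)
    k≡     : k ≡ (∑[ j < n ] D (above (suc u) j)) + r
    prefix : sum (take k (degSeqFrom D K)) ≡ (∑[ j < n ] D (above (suc u) j) * above (suc u) j) + r * suc u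
    suffix : ∀ f → sum (map f (drop k (degSeqFrom D K)))
               ≡ (D (suc u) ∸ r) * f (suc u) + (∑[ i < u ] D (suc i) * f (suc i))

within-top : ∀ D m k → 1 ≤ k → k ≤ D (suc m) → PrefixSplit D (suc m) k
within-top D m k 1≤k k≤D = prefix-split m 0 k (cong suc (sym (+-identityʳ m))) 1≤k k≤D refl
  (trans (cong sum (take-replicate-++ (suc m) (degSeqFrom D m) k≤D)) (sum-replicate k (suc m)))
  (λ f → trans (cong (λ l → sum (map f l)) (drop-replicate-++ (suc m) (degSeqFrom D m) k≤D))
               (trans (sum-map-replicate-++ f (D (suc m) ∸ k) (suc m) (degSeqFrom D m))
                      (cong ((D (suc m) ∸ k) * f (suc m) +_) (sum-map-degSeqFrom D f m))))

past-top : ∀ D m k → PrefixSplit D m k → PrefixSplit D (suc m) (D (suc m) + k)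
past-top D .(suc u + n) k (prefix-split u n r refl 1≤r r≤D k≡ prefix suffix) =
  prefix-split u (suc n) r (sym (+-suc (suc u) n)) 1≤r r≤D
    (trans (cong (D top +_) k≡) (sym (+-assoc (D top) size r)))
    (begin
      sum (take (D top + k) (replicate (D top) top ++ rest))   ≡⟨ cong sum (take-past-replicate (D top) k top rest) ⟩
      sum (replicate (D top) top ++ take k rest)              ≡⟨ sum-++ (replicate (D top) top) (take k rest) ⟩
      sum (replicate (D top) top) + sum (take k rest)         ≡⟨ cong₂ _+_ (sum-replicate (D top) top) prefix ⟩
      D top * top + (high + r * suc u)                        ≡⟨ sym (+-assoc (D top * top) high (r * suc u)) ⟩
      D top * top + high + r * suc u                          ∎)
    (λ f → trans (cong (λ l → sum (map f l)) (drop-past-replicate (D top) k top rest)) (suffix f))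
  where
  open ≡-Reasoning
  top size high : ℕ
  top  = above (suc u) n
  size = ∑[ j < n ] D (above (suc u) j)
  high = ∑[ j < n ] D (above (suc u) j) * above (suc u) j
  rest : List ℕ
  rest = degSeqFrom D (suc u + n)

prefixSplit : ∀ D K k → 1 ≤ k → k ≤ length (degSeqFrom D K) → PrefixSplit D K k
prefixSplit D zero    (suc k) _ ()
prefixSplit D (suc m) k 1≤k k≤len with k ≤? D (suc m)
... | yes k≤D = within-top D m k 1≤k k≤D
... | no  k≰D = subst (PrefixSplit D (suc m)) (m+[n∸m]≡n (<⇒≤ D<k))
    (past-top D m (k ∸ D (suc m)) (prefixSplit D m (k ∸ D (suc m)) (m<n⇒0<n∸m D<k) rest≤))
  where
  D<k : D (suc m) < k
  D<k = ≰⇒> k≰D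
  rest≤ : k ∸ D (suc m) ≤ length (degSeqFrom D m)
  rest≤ = m≤n+o⇒m∸n≤o k (D (suc m)) (subst (k ≤_) (length-degSeqFrom-suc D m) k≤len)

-- The weight is w = D_t, and e = w - r vertices of class t are not chosen.
module Counting (K : ℕ) (J : ℕ → ℕ → ℕ)
  (symmetric : ∀ a b → J a b ≡ J b a)
  (divisible : ∀ a → 1 ≤ a → a ∣ (J a a + rowSum J K a))
  (offDiagonal : ∀ a b → 1 ≤ a → 1 ≤ b → a ≢ b → J a b ≤ Dk J K a * Dk J K b)
  (diagonal : ∀ a → 1 ≤ a → J a a ≤ Dk J K a C 2)
  (u n r k : ℕ) (K≡ : K ≡ suc u + n) (1≤r : 1 ≤ r) (r≤D : r ≤ Dk J K (suc u))
  (k≡ : k ≡ (∑[ j < n ] Dk J K (above (suc u) j)) + r)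
  where

  D : ℕ → ℕ
  D = Dk J K

  t : ℕ
  t = suc u

  hi : ℕ → ℕ
  hi = above t

  N w e : ℕ
  N = ∑[ j < n ] D (hi j)
  w = D t
  e = w ∸ r

  w≡ : w ≡ r + e
  w≡ = sym (m+[n∸m]≡n r≤D)

  instance
    w-nonZero : NonZero w
    w-nonZero = >-nonZero (≤-trans 1≤r r≤D)

  H L : ℕ → ℕ
  H a = ∑[ j < n ] J a (hi j)
  L a = ∑[ i < u ] J a (suc i)

  degree-split : ∀ a → 1 ≤ a → a * D a ≡ J a a + (H a + (J a t + L a))
  degree-split a@(suc _) _ = trans (m*[n/m]≡n (divisible a (s≤s z≤n))) (cong (J a a +_) row)
    where
    row : rowSum J K a ≡ H a + (J a t + L a)
    row = begin
      rowSum J K a                   ≡⟨ ∑-applyUpTo K (λ i → J a (suc i)) ⟩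
      ∑[ i < K ] J a (suc i)         ≡⟨ cong (λ m → ∑[ i < m ] J a (suc i)) K≡ ⟩
      ∑[ i < suc u + n ] J a (suc i) ≡⟨ ∑-split (suc u) n (λ i → J a (suc i)) ⟩
      H a + (J a t + L a)            ∎
      where open ≡-Reasoning

  t<hi : ∀ j → t < hi j
  t<hi j = s≤s (s≤s (m≤m+n u j))

  hi-injective : ∀ {i j} → hi i ≡ hi j → i ≡ j
  hi-injective {i} {j} eq = +-cancelˡ-≡ u i j (suc-injective (suc-injective eq))

  diagonal′ : ∀ a → 1 ≤ a → 2 * J a a + D a ≤ D a * D a
  diagonal′ a 1≤a =
    subst (2 * J a a + D a ≤_) (double-choose-2 (D a)) (+-monoˡ-≤ (D a) (*-monoʳ-≤ 2 (diagonal a 1≤a)))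

  fromHigh : ℕ → ℕ
  fromHigh b = ∑[ j < n ] J (hi j) b

  fromHigh≡H : ∀ b → fromHigh b ≡ H b
  fromHigh≡H b = ∑-cong n (λ j _ → symmetric (hi j) b)

  fromHigh-bound : ∀ b → 1 ≤ b → b ≤ t → fromHigh b ≤ D b * N
  fromHigh-bound b 1≤b b≤t = ≤-trans (∑-mono n perClass) (≤-reflexive (sym (∑-*ˡ n (D b) (λ j → D (hi j)))))
    where
    perClass : ∀ j → j < n → J (hi j) b ≤ D b * D (hi j)
    perClass j _ = subst (J (hi j) b ≤_) (*-comm (D (hi j)) (D b))
      (offDiagonal (hi j) b (s≤s z≤n) 1≤b (>⇒≢ (≤-<-trans b≤t (t<hi j))))

  -- The pieces of the weighted degree sum (see `assemble`): LHS is the sum of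
  -- the k largest degrees; SA the edges at high classes that stay high (plus
  -- the loops J_aa once more); SB the edges between high classes and t,
  -- weighted w at the high end and r at t; SJt the same edges unweighted;
  -- JJ the edges inside t and X its spill-over; SD the weighted edges into
  -- the low classes; Ls the low part of the right-hand side.
  LHS SA SB SJt JJ X SD Ls : ℕ
  LHS = (∑[ j < n ] D (hi j) * hi j) + r * t
  SA  = ∑[ j < n ] (J (hi j) (hi j) + H (hi j))
  SB  = ∑[ j < n ] (w * J (hi j) t + r * J t (hi j))
  SJt = fromHigh t
  JJ  = J t t
  X   = (r * w) ⊓ (2 * JJ)
  SD  = ∑[ i < u ] (w * fromHigh (suc i) + r * J t (suc i))
  Ls  = ∑[ i < u ] D (suc i) * (suc i ⊓ k)

  -- (A) All edges of a high class a inside the high classes meet only N vertices.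
  bound-A : SA + N ≤ N * N
  bound-A = begin
    SA + N                                              ≡⟨ sym (∑-+ n _ (λ j → D (hi j))) ⟩
    ∑[ j < n ] (J (hi j) (hi j) + H (hi j) + D (hi j)) ≤⟨ ∑-mono n highRow ⟩
    ∑[ j < n ] (N * D (hi j))                          ≡⟨ sym (∑-*ˡ n N (λ j → D (hi j))) ⟩
    N * N                                               ∎
    where
    open ≤-Reasoning
    highRow : ∀ j → j < n → J (hi j) (hi j) + H (hi j) + D (hi j) ≤ N * D (hi j)
    highRow j j<n = subst₂ _≤_ (swap-front (J a a) (H a) (D a)) (trans (sym (∑-*ˡ n (D a) (λ i → D (hi i)))) (*-comm (D a) N))
        (∑-mono-surplus n j (J a a + D a) j<n
          (λ i _ i≢j → offDiagonal a (hi i) (s≤s z≤n) (s≤s z≤n) (λ eq → i≢j (sym (hi-injective eq))))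
          (subst (_≤ D a * D a) (double-front (J a a) (D a)) (diagonal′ a (s≤s z≤n))))
      where
      a : ℕ
      a = hi j
      swap-front : ∀ x y z → y + (x + z) ≡ x + y + z
      swap-front = solve-∀
      double-front : ∀ x z → 2 * x + z ≡ x + (x + z)
      double-front = solve-∀

  bound-B : SB ≤ e * SJt + 2 * r * (w * N)
  bound-B = begin
    SB                                                        ≤⟨ ∑-mono n perClass ⟩
    ∑[ j < n ] (e * J (hi j) t + 2 * r * (w * D (hi j)))      ≡⟨ ∑-+ n _ _ ⟩
    (∑[ j < n ] e * J (hi j) t) + (∑[ j < n ] 2 * r * (w * D (hi j)))
      ≡⟨ cong₂ _+_ (sym (∑-*ˡ n e _)) (trans (sym (∑-*ˡ n (2 * r) _)) (cong (2 * r *_) (sym (∑-*ˡ n w _)))) ⟩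
    e * SJt + 2 * r * (w * N)                                 ∎
    where
    open ≤-Reasoning
    perClass : ∀ j → j < n → w * J (hi j) t + r * J t (hi j) ≤ e * J (hi j) t + 2 * r * (w * D (hi j))
    perClass j _ = subst (λ y → w * J (hi j) t + r * y ≤ e * J (hi j) t + 2 * r * (w * D (hi j))) (symmetric (hi j) t)
      (high-to-t r e (J (hi j) t) (D (hi j)) w≡
        (offDiagonal (hi j) t (s≤s z≤n) (s≤s z≤n) (>⇒≢ (t<hi j))))

  bound-C : 2 * r * JJ + r * w ≤ r * r * w + e * X
  bound-C = class-t-internal r e JJ w≡ 1≤r (diagonal′ t (s≤s z≤n))

  bound-D : SD ≤ w * Ls
  bound-D = ≤-trans (∑-mono u perClass) (≤-reflexive (sym (∑-*ˡ u w _)))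
    where
    perClass : ∀ i → i < u → w * fromHigh (suc i) + r * J t (suc i) ≤ w * (D (suc i) * (suc i ⊓ k))
    perClass i i<u = subst (λ k′ → w * fromHigh b + r * J t b ≤ w * (D b * (b ⊓ k′))) (sym k≡)
        (low-class w r (fromHigh b) (J t b) b (D b) N r≤D byDegree
          (fromHigh-bound b (s≤s z≤n) (<⇒≤ b<t)) (offDiagonal t b (s≤s z≤n) (s≤s z≤n) (>⇒≢ b<t)))
      where
      open ≤-Reasoning
      b : ℕ
      b = suc i
      b<t : b < t
      b<t = s≤s i<u
      byDegree : fromHigh b + J t b ≤ b * D b
      byDegree = begin
        fromHigh b + J t b                 ≡⟨ cong₂ _+_ (fromHigh≡H b) (symmetric t b) ⟩
        H b + J b t                        ≤⟨ +-monoʳ-≤ (H b) (m≤m+n (J b t) (L b)) ⟩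
        H b + (J b t + L b)                ≤⟨ m≤n+m _ (J b b) ⟩
        J b b + (H b + (J b t + L b))      ≡⟨ sym (degree-split b (s≤s z≤n)) ⟩
        b * D b                            ∎

  bound-E : SJt + X ≤ w * (t ⊓ k)
  bound-E = subst (λ k′ → SJt + X ≤ w * (t ⊓ k′)) (sym k≡)
    (class-t-total w r JJ SJt t N byDegree (fromHigh-bound t (s≤s z≤n) ≤-refl))
    where
    open ≤-Reasoning
    byDegree : SJt + 2 * JJ ≤ t * w
    byDegree = begin
      SJt + 2 * JJ                   ≡⟨ cong (_+ 2 * JJ) (fromHigh≡H t) ⟩
      H t + 2 * JJ                   ≤⟨ m≤m+n _ (L t) ⟩
      H t + 2 * JJ + L t             ≡⟨ sym (regroup JJ (H t) (L t)) ⟩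
      JJ + (H t + (JJ + L t))        ≡⟨ sym (degree-split t (s≤s z≤n)) ⟩
      t * w                          ∎
      where
      regroup : ∀ x h l → x + (h + (x + l)) ≡ h + 2 * x + l
      regroup = solve-∀

  P₂ P₃ : ℕ
  P₂ = ∑[ j < n ] w * J (hi j) t
  P₃ = ∑[ j < n ] w * L (hi j)

  weighted-high-degrees : w * (∑[ j < n ] D (hi j) * hi j) ≡ w * SA + (P₂ + P₃)
  weighted-high-degrees = begin
    w * (∑[ j < n ] D (hi j) * hi j)
      ≡⟨ ∑-*ˡ n w _ ⟩
    ∑[ j < n ] w * (D (hi j) * hi j)
      ≡⟨ ∑-cong n (λ j _ → perClass (hi j) (s≤s z≤n)) ⟩
    ∑[ j < n ] (w * (J (hi j) (hi j) + H (hi j)) + (w * J (hi j) t + w * L (hi j)))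
      ≡⟨ ∑-+ n _ _ ⟩
    (∑[ j < n ] w * (J (hi j) (hi j) + H (hi j))) + (∑[ j < n ] (w * J (hi j) t + w * L (hi j)))
      ≡⟨ cong₂ _+_ (sym (∑-*ˡ n w _)) (∑-+ n _ _) ⟩
    w * SA + (P₂ + P₃) ∎
    where
    open ≡-Reasoning
    distribute : ∀ w x y z l → w * (x + (y + (z + l))) ≡ w * (x + y) + (w * z + w * l)
    distribute = solve-∀
    perClass : ∀ a → 1 ≤ a → w * (D a * a) ≡ w * (J a a + H a) + (w * J a t + w * L a)
    perClass a 1≤a = trans (cong (w *_) (trans (*-comm (D a) a) (degree-split a 1≤a)))
                           (distribute w (J a a) (H a) (J a t) (L a))

  SB≡ : SB ≡ P₂ + r * H t
  SB≡ = trans (∑-+ n _ _) (cong (P₂ +_) (sym (∑-*ˡ n r _)))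

  -- The edges from the high to the low classes, counted from either side.
  SD≡ : SD ≡ P₃ + r * L t
  SD≡ = trans (∑-+ u _ _) (cong₂ _+_ highToLow (sym (∑-*ˡ u r _)))
    where
    highToLow : (∑[ i < u ] w * fromHigh (suc i)) ≡ P₃
    highToLow = trans (sym (∑-*ˡ u w _)) (trans (cong (w *_) (∑-swap u n (λ i j → J (hi j) (suc i)))) (∑-*ˡ n w _))

  weighted-degree-sum : w * LHS ≡ w * SA + SB + 2 * r * JJ + SD
  weighted-degree-sum = begin
    w * LHS                                                  ≡⟨ *-distribˡ-+ w _ (r * t) ⟩
    w * (∑[ j < n ] D (hi j) * hi j) + w * (r * t)           ≡⟨ cong₂ _+_ weighted-high-degrees chosenPart ⟩
    w * SA + (P₂ + P₃) + r * (JJ + (H t + (JJ + L t)))       ≡⟨ regroup w SA P₂ P₃ r JJ (H t) (L t) ⟩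
    w * SA + (P₂ + r * H t) + 2 * r * JJ + (P₃ + r * L t)    ≡⟨ cong₂ (λ x y → w * SA + x + 2 * r * JJ + y) (sym SB≡) (sym SD≡) ⟩
    w * SA + SB + 2 * r * JJ + SD                            ∎
    where
    open ≡-Reasoning
    rotate : ∀ w r t → w * (r * t) ≡ r * (t * w)
    rotate = solve-∀
    chosenPart : w * (r * t) ≡ r * (JJ + (H t + (JJ + L t)))
    chosenPart = trans (rotate w r t) (cong (r *_) (degree-split t (s≤s z≤n)))
    regroup : ∀ w SA P₂ P₃ r x h l → w * SA + (P₂ + P₃) + r * (x + (h + (x + l)))
      ≡ w * SA + (P₂ + r * h) + 2 * r * x + (P₃ + r * l)
    regroup = solve-∀

  degree-bound : LHS ≤ k * (k ∸ 1) + (e * (t ⊓ k) + Ls)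
  degree-bound = cancel-weight w k
    (subst (λ k′ → w * (LHS + k′) ≤ w * (k′ * k′ + (e * (t ⊓ k) + Ls))) (sym k≡)
      (assemble {X = X} {e = e} {m = t ⊓ k} {Ls = Ls} w weighted-degree-sum bound-A bound-B bound-C bound-D bound-E))

-- Locate the prefix of length k in the degree sequence and apply the counting
-- argument.
mainTheorem4 : (K : ℕ) (J : ℕ → ℕ → ℕ) →
    (∀ k l → J k l ≢ 0 → (1 ≤ k × k ≤ K) × (1 ≤ l × l ≤ K)) →
    (∀ k l → J k l ≡ J l k) →
    (∀ k → 1 ≤ k → k ∣ (J k k + rowSum J K k)) →
    (∀ k l → 1 ≤ k → 1 ≤ l → k ≢ l → J k l ≤ Dk J K k * Dk J K l) →
    (∀ k → 1 ≤ k → J k k ≤ Dk J K k C 2) →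
    ∀ k → 1 ≤ k → k ≤ length (degSeq J K) →
    sum (take k (degSeq J K))
    ≤ k * (k ∸ 1) + sum (map (λ d → d ⊓ k) (drop k (degSeq J K)))
mainTheorem4 K J _ symmetric divisible offDiagonal diagonal k 1≤k k≤length =
  subst₂ _≤_ (sym prefix) (cong (k * (k ∸ 1) +_) (sym (suffix (λ d → d ⊓ k)))) degree-bound
  where
  open PrefixSplit (prefixSplit (Dk J K) K k 1≤k k≤length)
  open Counting K J symmetric divisible offDiagonal diagonal u n r k K≡ 1≤r r≤D k≡ using (degree-bound)
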